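{- Let $\alpha\colon L\rightharpoonup R$ be a rule and $f\colon L\to G$, $g\colon R\to H$, $g_1\colon R\to T$ matches such that $f\Rightarrow_\alpha g$ but $g_1$ is not derivable by $\alpha$. Then there is no match $g_2\colon T\to H$ such that $g_2\circ g_1=g$.
   Context: A directed multigraph $G$ consists of finite sets $V_G$, $E_G$ and maps $s_G,t_G\colon E_G\to V_G$; morphisms are pairs of maps on nodes and edges commuting with sources and targets. A match is a morphism injective on nodes and edges. A rule $\alpha\colon L\rightharpoonup R$ is a span $L\xleftarrow{\alpha_1}K\xrightarrow{\alpha_2}R$ of matches. Final pullback complement (FPBC) of $X\xrightarrow{f_1}Y\xrightarrow{f_2}Z$: a pair $X\xrightarrow{g_1}W\xrightarrow{g_2}Z$ making a pullback square with $g_2\circ g_1=f_2\circ f_1$, such that for every pullback square $P\xrightarrow{f_1'}Y\xrightarrow{f_2}Z\xleftarrow{g_2'}Q\xleftarrow{g_1'}P$ and $p\colon P\to X$ with $f_1\circ p=f_1'$ there is a unique $u\colon Q\to W$ with $g_2\circ u=g_2'$, $u\circ g_1'=g_1\circ p$. A derivation of a comatch $g\colon R\to H$ from a match $f\colon L\to G$ by $\alpha=(\alpha_1\colon K\to L,\alpha_2\colon K\to R)$ consists of a match $h\colon K\to D$ and morphisms $\beta_1\colon D\to G$, $\beta_2\colon D\to H$ such that $K\xrightarrow{h}D\xrightarrow{\beta_1}G$ is an FPBC of $K\xrightarrow{\alpha_1}L\xrightarrow{f}G$, the square $\alpha_2,h,g,\beta_2$ is a pushout of graphs, $g$ is a match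 and $(\beta_1,\beta_2)$ is a rule (the corule). Notation $f\Rightarrow_\alpha g$. A match $g_1\colon R\to T$ is derivable by $\alpha$ if there is a match $f_1$ with $f_1\Rightarrow_\alpha g_1$. -}

module Defs where

open import Data.Nat using (ℕ)
open import Data.Fin using (Fin)
open import Data.Product using (Σ; _×_; _,_)
open import Relation.Binary.PropositionalEquality using (_≡_; refl; trans; cong)
open import Function.Definitions using (Injective)

record Graph : Set where
  field
    nV  : ℕ
    nE  : ℕ
    src : Fin nE → Fin nV
    tgt : Fin nE → Fin nV

open Graph public

V : Graph → Set
V G = Fin (nV G)

E : Graph → Set
E G = Fin (nE G)

record Hom (G H : Graph) : Set where
  field
    vm : V G → V H
    em : E G → E H
    src-comm : ∀ e → vm (src G e) ≡ src H (em e)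
    tgt-comm : ∀ e → vm (tgt G e) ≡ tgt H (em e)

open Hom public

infix 4 _≈_
_≈_ : {G H : Graph} → Hom G H → Hom G H → Set
f ≈ g = (∀ v → vm f v ≡ vm g v) × (∀ e → em f e ≡ em g e)

infixr 9 _∘_
_∘_ : {A B C : Graph} → Hom B C → Hom A B → Hom A C
g ∘ f = record
  { vm = λ v → vm g (vm f v)
  ; em = λ e → em g (em f e)
  ; src-comm = λ e → trans (cong (vm g) (src-comm f e)) (src-comm g (em f e))
  ; tgt-comm = λ e → trans (cong (vm g) (tgt-comm f e)) (tgt-comm g (em f e))
  }

IsMatch : {G H : Graph} → Hom G H → Set
IsMatch f = Injective _≡_ _≡_ (vm f) × Injective _≡_ _≡_ (em f)

IsPullback : {A B C D : Graph} → Hom A B → Hom A C → Hom B D → Hom C D → Set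
IsPullback {A} {B} {C} {D} a b c d =
  (c ∘ a ≈ d ∘ b) ×
  (∀ (X : Graph) (x₁ : Hom X B) (x₂ : Hom X C) → c ∘ x₁ ≈ d ∘ x₂ →
     Σ (Hom X A) λ u → (a ∘ u ≈ x₁) × (b ∘ u ≈ x₂) ×
       (∀ (u' : Hom X A) → a ∘ u' ≈ x₁ → b ∘ u' ≈ x₂ → u' ≈ u))

IsPushout : {A B C D : Graph} → Hom A B → Hom A C → Hom B D → Hom C D → Set
IsPushout {A} {B} {C} {D} a b c d =
  (c ∘ a ≈ d ∘ b) ×
  (∀ (X : Graph) (x₁ : Hom B X) (x₂ : Hom C X) → x₁ ∘ a ≈ x₂ ∘ b →
     Σ (Hom D X) λ u → (u ∘ c ≈ x₁) × (u ∘ d ≈ x₂) ×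
       (∀ (u' : Hom D X) → u' ∘ c ≈ x₁ → u' ∘ d ≈ x₂ → u' ≈ u))

-- (g₁ : X → W, g₂ : W → Z) is a final pullback complement of X --f₁--> Y --f₂--> Z.
IsFPBC : {X Y Z W : Graph} → Hom X Y → Hom Y Z → Hom X W → Hom W Z → Set
IsFPBC {X} {Y} {Z} {W} f₁ f₂ g₁ g₂ =
  IsPullback f₁ g₁ f₂ g₂ ×
  (∀ (P Q : Graph) (f₁' : Hom P Y) (g₁' : Hom P Q) (g₂' : Hom Q Z) →
     IsPullback f₁' g₁' f₂ g₂' →
     (p : Hom P X) → f₁ ∘ p ≈ f₁' →
     Σ (Hom Q W) λ u → (g₂ ∘ u ≈ g₂') × (u ∘ g₁' ≈ g₁ ∘ p) ×
       (∀ (u' : Hom Q W) → g₂ ∘ u' ≈ g₂' → u' ∘ g₁' ≈ g₁ ∘ p → u' ≈ u))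

-- A rule L ⇀ R: a span L <-α₁- K -α₂-> R of matches.
record Rule (L R : Graph) : Set where
  field
    K  : Graph
    α₁ : Hom K L
    α₂ : Hom K R
    α₁-match : IsMatch α₁
    α₂-match : IsMatch α₂

open Rule public

Derivation : {L R G H : Graph} → Rule L R → Hom L G → Hom R H → Set
Derivation {L} {R} {G} {H} α f g =
  Σ Graph λ D → Σ (Hom (K α) D) λ h → Σ (Hom D G) λ β₁ → Σ (Hom D H) λ β₂ →
    IsMatch h × IsFPBC (α₁ α) f h β₁ × IsPushout (α₂ α) h g β₂ ×
    IsMatch g × IsMatch β₁ × IsMatch β₂

Derivable : {L R T : Graph} → Rule L R → Hom R T → Set
Derivable {L} {R} {T} α g₁ =
  Σ Graph λ G → Σ (Hom L G) λ f₁ → IsMatch f₁ × Derivation α f₁ g₁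

-- A match g₂ : T → H with g₂ ∘ g₁ = g would make g₁ derivable.  Let D′ ⊆ D be the preimage of g₂(T) under β₂ and
-- G′ ⊆ G the part covered by f and β₁(D′).  Then g₁ is derived from the corestriction f₁ : L → G′:
-- restricting the pushout (α₂, h, g, β₂) along g₂ gives a pushout, since pushouts of matches are
-- characterised elementwise (jointly surjective, overlapping exactly on the image of K); and
-- restricting the FPBC (α₁, h, f, β₁) along G′ ↪ G gives an FPBC, because β₁⁻¹(G′) ⊆ D′ (by the
-- pullback property, β₁(x) ∈ f(L) forces x ∈ h(K)), so every mediating map into D factors through D′.

module Submission where

open import Defs
open import Data.Bool using (if_then_else_)
open import Data.Fin using (Fin; zero; suc; _≟_; combine; remQuot)
open import Data.Fin.Patterns using (0F; 1F)
open import Data.Fin.Properties using (any?; remQuot-combine; combine-remQuot)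
open import Data.List using (List; filter; lookup; length; allFin)
open import Data.List.Membership.Propositional.Properties using (∈-filter⁺; ∈-filter⁻; ∈-allFin; ∈-lookup)
open import Data.List.Relation.Unary.All as All using ()
open import Data.List.Relation.Unary.AllPairs using (_∷_)
open import Data.List.Relation.Unary.Any using (index)
open import Data.List.Relation.Unary.Any.Properties using (lookup-index)
open import Data.List.Relation.Unary.Unique.Propositional using (Unique)
open import Data.List.Relation.Unary.Unique.Propositional.Properties using (filter⁺; allFin⁺)
open import Data.Nat using (ℕ; _*_)
open import Data.Product using (Σ; ∃; _×_; _,_; proj₁; proj₂)
open import Data.Sum using (_⊎_; inj₁; inj₂)
open import Function.Definitions using (Injective)
open import Level using (0ℓ)
open import Relation.Binary.Bundles using (Setoid)
open import Relation.Binary.PropositionalEquality using (_≡_; refl; sym; trans; cong; cong₂; subst; module ≡-Reasoning)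
import Relation.Binary.Reasoning.Setoid as SetoidReasoning
open import Relation.Nullary using (¬_; yes; no; does; contradiction)
open import Relation.Nullary.Decidable using (dec-true; dec-false; _⊎-dec_)
open import Relation.Unary using (Pred; Decidable)

private
  variable
    A B C D X Y : Graph

≈-refl : {φ : Hom A B} → φ ≈ φ
≈-refl = (λ _ → refl) , (λ _ → refl)

≈-sym : {φ ψ : Hom A B} → φ ≈ ψ → ψ ≈ φ
≈-sym (p , q) = (λ x → sym (p x)) , (λ e → sym (q e))

≈-trans : {φ ψ χ : Hom A B} → φ ≈ ψ → ψ ≈ χ → φ ≈ χ
≈-trans (p , q) (p' , q') = (λ x → trans (p x) (p' x)) , (λ e → trans (q e) (q' e))

Hom-setoid : Graph → Graph → Setoid _ _
Hom-setoid A B = record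
  { Carrier = Hom A B
  ; _≈_ = _≈_
  ; isEquivalence = record
    { refl = λ {φ} → ≈-refl {φ = φ}
    ; sym = λ {φ} {ψ} → ≈-sym {φ = φ} {ψ}
    ; trans = λ {φ} {ψ} {χ} → ≈-trans {φ = φ} {ψ} {χ}
    }
  }

module ≈-Reasoning {A B : Graph} = SetoidReasoning (Hom-setoid A B)

-- _≈_ unfolds to a pair of pointwise equations, so Agda never infers the morphisms it relates;
-- they are therefore given explicitly throughout.
∘-congˡ : (ψ : Hom B C) {φ φ' : Hom A B} → φ ≈ φ' → ψ ∘ φ ≈ ψ ∘ φ'
∘-congˡ ψ (p , q) = (λ v → cong (vm ψ) (p v)) , (λ e → cong (em ψ) (q e))

∘-congʳ : (φ : Hom A B) {ψ ψ' : Hom B C} → ψ ≈ ψ' → ψ ∘ φ ≈ ψ' ∘ φ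
∘-congʳ φ (p , q) = (λ v → p (vm φ v)) , (λ e → q (em φ e))

match-cancelˡ : (m : Hom B C) → IsMatch m → {φ φ' : Hom A B} → m ∘ φ ≈ m ∘ φ' → φ ≈ φ'
match-cancelˡ _ (injᵛ , injᵉ) (p , q) = (λ v → injᵛ (p v)) , (λ e → injᵉ (q e))

IsMatch-∘ : {ψ : Hom B C} {φ : Hom A B} → IsMatch ψ → IsMatch φ → IsMatch (ψ ∘ φ)
IsMatch-∘ (ψᵛ , ψᵉ) (φᵛ , φᵉ) = (λ eq → φᵛ (ψᵛ eq)) , (λ eq → φᵉ (ψᵉ eq))

IsMatch-factor : (m : Hom B C) {ψ : Hom A B} {φ : Hom A C} → m ∘ ψ ≈ φ → IsMatch φ → IsMatch ψ
IsMatch-factor m (p , q) (φᵛ , φᵉ) =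
  (λ {x} {y} eq → φᵛ (trans (sym (p x)) (trans (cong (vm m) eq) (p y)))) ,
  (λ {x} {y} eq → φᵉ (trans (sym (q x)) (trans (cong (em m) eq) (q y))))

Imᵛ : Hom A B → V B → Set
Imᵛ φ y = ∃ λ x → vm φ x ≡ y

Imᵉ : Hom A B → E B → Set
Imᵉ φ y = ∃ λ e → em φ e ≡ y

Imᵛ? : (φ : Hom A B) → Decidable (Imᵛ φ)
Imᵛ? φ y = any? (λ x → vm φ x ≟ y)

Imᵉ? : (φ : Hom A B) → Decidable (Imᵉ φ)
Imᵉ? φ y = any? (λ e → em φ e ≟ y)

module _ (m : Hom B C) (m-match : IsMatch m) {ψ : Hom A B} {φ : Hom A C} (m∘ψ≈φ : m ∘ ψ ≈ φ) where

  Imᵛ-cancel : ∀ {y} → Imᵛ φ (vm m y) → Imᵛ ψ y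
  Imᵛ-cancel (x , eq) = x , proj₁ m-match (trans (proj₁ m∘ψ≈φ x) eq)

  Imᵉ-cancel : ∀ {y} → Imᵉ φ (em m y) → Imᵉ ψ y
  Imᵉ-cancel (e , eq) = e , proj₂ m-match (trans (proj₂ m∘ψ≈φ e) eq)

module _ (m : Hom B C) {ψ : Hom A B} {φ : Hom A C} (m∘ψ≈φ : m ∘ ψ ≈ φ) where

  Imᵛ-factor : ∀ {y} → Imᵛ φ y → Imᵛ m y
  Imᵛ-factor (x , eq) = vm ψ x , trans (proj₁ m∘ψ≈φ x) eq

  Imᵉ-factor : ∀ {y} → Imᵉ φ y → Imᵉ m y
  Imᵉ-factor (e , eq) = em ψ e , trans (proj₂ m∘ψ≈φ e) eq

factorise : (m : Hom B C) → IsMatch m → (φ : Hom A C) →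
            (∀ x → Imᵛ m (vm φ x)) → (∀ e → Imᵉ m (em φ e)) →
            Σ (Hom A B) λ ψ → m ∘ ψ ≈ φ
factorise {B} {C} {A} m (m-injᵛ , _) φ inᵛ inᵉ =
  record { vm = λ x → proj₁ (inᵛ x) ; em = λ e → proj₁ (inᵉ e)
         ; src-comm = endpoint-comm src src-comm ; tgt-comm = endpoint-comm tgt tgt-comm } ,
  (λ x → proj₂ (inᵛ x)) , (λ e → proj₂ (inᵉ e))
  where
  endpoint-comm : (s : (G : Graph) → E G → V G) →
                  (∀ {G H} (χ : Hom G H) e → vm χ (s G e) ≡ s H (em χ e)) →
                  ∀ e → proj₁ (inᵛ (s A e)) ≡ s B (proj₁ (inᵉ e))
  endpoint-comm s s-comm e = m-injᵛ (begin
    vm m (proj₁ (inᵛ (s A e)))  ≡⟨ proj₂ (inᵛ (s A e)) ⟩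
    vm φ (s A e)                ≡⟨ s-comm φ e ⟩
    s C (em φ e)                ≡⟨ cong (s C) (proj₂ (inᵉ e)) ⟨
    s C (em m (proj₁ (inᵉ e)))  ≡⟨ s-comm m (proj₁ (inᵉ e)) ⟨
    vm m (s B (proj₁ (inᵉ e)))  ∎)
    where open ≡-Reasoning

lookup-injective : {S : Set} {xs : List S} → Unique xs → Injective _≡_ _≡_ (lookup xs)
lookup-injective (_ ∷ _) {zero} {zero} _ = refl
lookup-injective (x∉ ∷ _) {zero} {suc j} eq = contradiction eq (All.lookup x∉ (∈-lookup j))
lookup-injective (x∉ ∷ _) {suc i} {zero} eq = contradiction (sym eq) (All.lookup x∉ (∈-lookup i))
lookup-injective (_ ∷ u) {suc i} {suc j} eq = cong suc (lookup-injective u eq)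

record Enumeration {n : ℕ} (P : Pred (Fin n) 0ℓ) : Set where
  field
    size : ℕ
    enum : Fin size → Fin n
    enum-injective : Injective _≡_ _≡_ enum
    enum-sound : ∀ i → P (enum i)
    enum-complete : ∀ {x} → P x → ∃ λ i → enum i ≡ x

enumerate : ∀ {n} {P : Pred (Fin n) 0ℓ} → Decidable P → Enumeration P
enumerate {n} P? = record
  { size = length xs
  ; enum = lookup xs
  ; enum-injective = lookup-injective (filter⁺ P? (allFin⁺ n))
  ; enum-sound = λ i → proj₂ (∈-filter⁻ P? {xs = allFin n} (∈-lookup i))
  ; enum-complete = λ {x} p → let x∈xs = ∈-filter⁺ P? (∈-allFin x) p in
                              index x∈xs , sym (lookup-index x∈xs)
  }
  where
  xs = filter P? (allFin n)

record Subgraph (A : Graph) : Set₁ where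
  field
    Node : V A → Set
    Edge : E A → Set
    Node? : Decidable Node
    Edge? : Decidable Edge
    src-closed : ∀ {e} → Edge e → Node (src A e)
    tgt-closed : ∀ {e} → Edge e → Node (tgt A e)

open Subgraph public

image : Hom A B → Subgraph B
image {A} {B} φ = record
  { Node = Imᵛ φ ; Edge = Imᵉ φ ; Node? = Imᵛ? φ ; Edge? = Imᵉ? φ
  ; src-closed = λ (e , eq) → src A e , trans (src-comm φ e) (cong (src B) eq)
  ; tgt-closed = λ (e , eq) → tgt A e , trans (tgt-comm φ e) (cong (tgt B) eq)
  }

preimage : Hom A B → Subgraph B → Subgraph A
preimage φ S = record
  { Node = λ x → Node S (vm φ x) ; Edge = λ e → Edge S (em φ e)
  ; Node? = λ x → Node? S (vm φ x) ; Edge? = λ e → Edge? S (em φ e)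
  ; src-closed = λ {e} p → subst (Node S) (sym (src-comm φ e)) (src-closed S p)
  ; tgt-closed = λ {e} p → subst (Node S) (sym (tgt-comm φ e)) (tgt-closed S p)
  }

_∪_ : Subgraph A → Subgraph A → Subgraph A
S ∪ S' = record
  { Node = λ x → Node S x ⊎ Node S' x ; Edge = λ e → Edge S e ⊎ Edge S' e
  ; Node? = λ x → Node? S x ⊎-dec Node? S' x ; Edge? = λ e → Edge? S e ⊎-dec Edge? S' e
  ; src-closed = λ { (inj₁ p) → inj₁ (src-closed S p) ; (inj₂ p) → inj₂ (src-closed S' p) }
  ; tgt-closed = λ { (inj₁ p) → inj₁ (tgt-closed S p) ; (inj₂ p) → inj₂ (tgt-closed S' p) }
  }

module _ {A : Graph} (S : Subgraph A) where
  private
    module Nodes = Enumeration (enumerate (Node? S))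
    module Edges = Enumeration (enumerate (Edge? S))

  ⟦_⟧ : Graph
  ⟦_⟧ = record
    { nV = Nodes.size ; nE = Edges.size
    ; src = λ i → proj₁ (Nodes.enum-complete (src-closed S (Edges.enum-sound i)))
    ; tgt = λ i → proj₁ (Nodes.enum-complete (tgt-closed S (Edges.enum-sound i)))
    }

  inclusion : Hom ⟦_⟧ A
  inclusion = record
    { vm = Nodes.enum ; em = Edges.enum
    ; src-comm = λ i → proj₂ (Nodes.enum-complete (src-closed S (Edges.enum-sound i)))
    ; tgt-comm = λ i → proj₂ (Nodes.enum-complete (tgt-closed S (Edges.enum-sound i)))
    }

  inclusion-match : IsMatch inclusion
  inclusion-match = Nodes.enum-injective , Edges.enum-injective

  inclusion-soundᵛ : ∀ i → Node S (vm inclusion i)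
  inclusion-soundᵛ = Nodes.enum-sound

  inclusion-soundᵉ : ∀ i → Edge S (em inclusion i)
  inclusion-soundᵉ = Edges.enum-sound

  inclusion-completeᵛ : ∀ {x} → Node S x → Imᵛ inclusion x
  inclusion-completeᵛ = Nodes.enum-complete

  inclusion-completeᵉ : ∀ {e} → Edge S e → Imᵉ inclusion e
  inclusion-completeᵉ = Edges.enum-complete

-- Morphisms into Codiscrete n (resp. Bouquet n) are determined by their node (resp. edge) map.
-- For n = 2 these graphs are test objects that turn universal properties into elementwise facts.
Codiscrete : ℕ → Graph
Codiscrete n = record { nV = n ; nE = n * n ; src = λ e → proj₁ (remQuot {n} n e) ; tgt = λ e → proj₂ (remQuot {n} n e) }

toCodiscrete : ∀ {n} → (V A → Fin n) → Hom A (Codiscrete n)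
toCodiscrete {A} {n} p = record
  { vm = p
  ; em = λ e → combine (p (src A e)) (p (tgt A e))
  ; src-comm = λ e → sym (cong proj₁ (remQuot-combine {n} {n} (p (src A e)) (p (tgt A e))))
  ; tgt-comm = λ e → sym (cong proj₂ (remQuot-combine {n} {n} (p (src A e)) (p (tgt A e))))
  }

codiscrete-≈ : ∀ {n} (φ ψ : Hom A (Codiscrete n)) → (∀ x → vm φ x ≡ vm ψ x) → φ ≈ ψ
codiscrete-≈ {A} {n} φ ψ φ≗ψ =
  φ≗ψ , λ e → trans (edge φ e) (trans (cong₂ combine (φ≗ψ (src A e)) (φ≗ψ (tgt A e))) (sym (edge ψ e)))
  where
  edge : (χ : Hom A (Codiscrete n)) → ∀ e → em χ e ≡ combine (vm χ (src A e)) (vm χ (tgt A e))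
  edge χ e = trans (sym (combine-remQuot {n} n (em χ e))) (cong₂ combine (sym (src-comm χ e)) (sym (tgt-comm χ e)))

Bouquet : ℕ → Graph
Bouquet n = record { nV = 1 ; nE = n ; src = λ _ → 0F ; tgt = λ _ → 0F }

toBouquet : ∀ {n} → (E A → Fin n) → Hom A (Bouquet n)
toBouquet p = record { vm = λ _ → 0F ; em = p ; src-comm = λ _ → refl ; tgt-comm = λ _ → refl }

indicator : ∀ {n} → Fin n → Fin n → Fin 2
indicator y x = if does (x ≟ y) then 1F else 0F

indicator-≡ : ∀ {n} (y : Fin n) → indicator y y ≡ 1F
indicator-≡ y = cong (λ b → if b then 1F else 0F) (dec-true (y ≟ y) refl)

indicator-≢ : ∀ {n} {x y : Fin n} → ¬ x ≡ y → indicator y x ≡ 0F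
indicator-≢ {x = x} {y} x≢y = cong (λ b → if b then 1F else 0F) (dec-false (x ≟ y) x≢y)

χᵛ : V A → Hom A (Codiscrete 2)
χᵛ y = toCodiscrete (indicator y)

κᵛ : Hom A (Codiscrete 2)
κᵛ = toCodiscrete (λ _ → 0F)

χᵉ : E A → Hom A (Bouquet 2)
χᵉ y = toBouquet (indicator y)

κᵉ : Hom A (Bouquet 2)
κᵉ = toBouquet (λ _ → 0F)

χᵛ-outside-image : (φ : Hom A B) {y : V B} → ¬ Imᵛ φ y → χᵛ y ∘ φ ≈ κᵛ ∘ φ
χᵛ-outside-image φ y∉φ = codiscrete-≈ (χᵛ _ ∘ φ) (κᵛ ∘ φ) λ x → indicator-≢ λ eq → y∉φ (x , eq)

χᵉ-outside-image : (φ : Hom A B) {y : E B} → ¬ Imᵉ φ y → χᵉ y ∘ φ ≈ κᵉ ∘ φ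
χᵉ-outside-image φ y∉φ = (λ _ → refl) , λ e → indicator-≢ λ eq → y∉φ (e , eq)

module _ {a : Hom A B} {b : Hom A C} {c : Hom B D} {d : Hom C D} (po : IsPushout a b c d) where

  pushout-jointly-epi : (φ ψ : Hom D X) → φ ∘ c ≈ ψ ∘ c → φ ∘ d ≈ ψ ∘ d → φ ≈ ψ
  pushout-jointly-epi {X} φ ψ φc≈ψc φd≈ψd =
    let (u , _ , _ , unique) = proj₂ po X (ψ ∘ c) (ψ ∘ d) (∘-congˡ ψ {c ∘ a} {d ∘ b} (proj₁ po))
    in ≈-trans {φ = φ} {u} {ψ} (unique φ φc≈ψc φd≈ψd)
               (≈-sym {φ = ψ} {u} (unique ψ (≈-refl {φ = ψ ∘ c}) (≈-refl {φ = ψ ∘ d})))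

  pushout-coverᵛ : ∀ y → Imᵛ c y ⊎ Imᵛ d y
  pushout-coverᵛ y with Imᵛ? c y | Imᵛ? d y
  ... | yes y∈c | _       = inj₁ y∈c
  ... | no _    | yes y∈d = inj₂ y∈d
  ... | no y∉c  | no y∉d  = contradiction
    (trans (sym (indicator-≡ y))
           (proj₁ (pushout-jointly-epi (χᵛ y) κᵛ (χᵛ-outside-image c y∉c) (χᵛ-outside-image d y∉d)) y))
    λ ()

  pushout-coverᵉ : ∀ y → Imᵉ c y ⊎ Imᵉ d y
  pushout-coverᵉ y with Imᵉ? c y | Imᵉ? d y
  ... | yes y∈c | _       = inj₁ y∈c
  ... | no _    | yes y∈d = inj₂ y∈d
  ... | no y∉c  | no y∉d  = contradiction
    (trans (sym (indicator-≡ y))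
           (proj₂ (pushout-jointly-epi (χᵉ y) κᵉ (χᵉ-outside-image c y∉c) (χᵉ-outside-image d y∉d)) y))
    λ ()

  module _ (d-match : IsMatch d) where

    pushout-overlapᵛ : ∀ {r x} → vm c r ≡ vm d x → ∃ λ k → vm a k ≡ r × vm b k ≡ x
    pushout-overlapᵛ {r} {x} cr≡dx with Imᵛ? a r
    ... | yes (k , ak≡r) = k , ak≡r , proj₁ d-match (begin
      vm d (vm b k)  ≡⟨ proj₁ (proj₁ po) k ⟨
      vm c (vm a k)  ≡⟨ cong (vm c) ak≡r ⟩
      vm c r         ≡⟨ cr≡dx ⟩
      vm d x         ∎)
      where open ≡-Reasoning
    ... | no r∉a =
      -- κᵛ ∘ a and κᵛ ∘ b are the same constant map.
      let (u , u∘c≈χ , u∘d≈κ , _) = proj₂ po _ (χᵛ r) κᵛ (χᵛ-outside-image a r∉a)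
      in contradiction (begin
        1F             ≡⟨ indicator-≡ r ⟨
        indicator r r  ≡⟨ proj₁ u∘c≈χ r ⟨
        vm u (vm c r)  ≡⟨ cong (vm u) cr≡dx ⟩
        vm u (vm d x)  ≡⟨ proj₁ u∘d≈κ x ⟩
        0F             ∎) λ ()
      where open ≡-Reasoning

    pushout-overlapᵉ : ∀ {r x} → em c r ≡ em d x → ∃ λ k → em a k ≡ r × em b k ≡ x
    pushout-overlapᵉ {r} {x} cr≡dx with Imᵉ? a r
    ... | yes (k , ak≡r) = k , ak≡r , proj₂ d-match (begin
      em d (em b k)  ≡⟨ proj₂ (proj₁ po) k ⟨
      em c (em a k)  ≡⟨ cong (em c) ak≡r ⟩
      em c r         ≡⟨ cr≡dx ⟩
      em d x         ∎)
      where open ≡-Reasoning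
    ... | no r∉a =
      let (u , u∘c≈χ , u∘d≈κ , _) = proj₂ po _ (χᵉ r) κᵉ (χᵉ-outside-image a r∉a)
      in contradiction (begin
        1F             ≡⟨ indicator-≡ r ⟨
        indicator r r  ≡⟨ proj₂ u∘c≈χ r ⟨
        em u (em c r)  ≡⟨ cong (em u) cr≡dx ⟩
        em u (em d x)  ≡⟨ proj₂ u∘d≈κ x ⟩
        0F             ∎) λ ()
      where open ≡-Reasoning

module Glue {I J Y Z : Set} {c : I → Y} {d : J → Y}
  (c-injective : Injective _≡_ _≡_ c) (d-injective : Injective _≡_ _≡_ d)
  (z₁ : I → Z) (z₂ : J → Z) (agree : ∀ {r x} → c r ≡ d x → z₁ r ≡ z₂ x) where

  Covered : Y → Set
  Covered y = (∃ λ r → c r ≡ y) ⊎ (∃ λ x → d x ≡ y)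

  glue : ∀ {y} → Covered y → Z
  glue (inj₁ (r , _)) = z₁ r
  glue (inj₂ (x , _)) = z₂ x

  glue-irrelevant : ∀ {y} (w w' : Covered y) → glue w ≡ glue w'
  glue-irrelevant (inj₁ (r , p)) (inj₁ (r' , p')) = cong z₁ (c-injective (trans p (sym p')))
  glue-irrelevant (inj₁ (r , p)) (inj₂ (x , q))   = agree (trans p (sym q))
  glue-irrelevant (inj₂ (x , q)) (inj₁ (r , p))   = sym (agree (trans p (sym q)))
  glue-irrelevant (inj₂ (x , q)) (inj₂ (x' , q')) = cong z₂ (d-injective (trans q (sym q')))

  glue-unique : (u : Y → Z) → (∀ r → u (c r) ≡ z₁ r) → (∀ x → u (d x) ≡ z₂ x) →
                ∀ {y} (w : Covered y) → u y ≡ glue w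
  glue-unique u uc≗z₁ _ (inj₁ (r , refl)) = uc≗z₁ r
  glue-unique u _ ud≗z₂ (inj₂ (x , refl)) = ud≗z₂ x

record IsElementwisePushout {A B C D : Graph}
         (a : Hom A B) (b : Hom A C) (c : Hom B D) (d : Hom C D) : Set where
  field
    commutes : c ∘ a ≈ d ∘ b
    c-match : IsMatch c
    d-match : IsMatch d
    coverᵛ : ∀ y → Imᵛ c y ⊎ Imᵛ d y
    coverᵉ : ∀ y → Imᵉ c y ⊎ Imᵉ d y
    overlapᵛ : ∀ {r x} → vm c r ≡ vm d x → ∃ λ k → vm a k ≡ r × vm b k ≡ x
    overlapᵉ : ∀ {r x} → em c r ≡ em d x → ∃ λ k → em a k ≡ r × em b k ≡ x

pushout⇒elementwise : {a : Hom A B} {b : Hom A C} {c : Hom B D} {d : Hom C D} →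
                      IsPushout a b c d → IsMatch c → IsMatch d → IsElementwisePushout a b c d
pushout⇒elementwise {a = a} {b} {c} {d} po c-match d-match = record
  { commutes = proj₁ po ; c-match = c-match ; d-match = d-match
  ; coverᵛ = pushout-coverᵛ {a = a} {b} {c} {d} po ; coverᵉ = pushout-coverᵉ {a = a} {b} {c} {d} po
  ; overlapᵛ = pushout-overlapᵛ {a = a} {b} {c} {d} po d-match
  ; overlapᵉ = pushout-overlapᵉ {a = a} {b} {c} {d} po d-match
  }

elementwise⇒pushout : {a : Hom A B} {b : Hom A C} {c : Hom B D} {d : Hom C D} →
                      IsElementwisePushout a b c d → IsPushout a b c d
elementwise⇒pushout {A} {B} {C} {D} {a} {b} {c} {d} sq = commutes , mediate
  where
  open IsElementwisePushout sq

  mediate : ∀ X (x₁ : Hom B X) (x₂ : Hom C X) → x₁ ∘ a ≈ x₂ ∘ b →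
            Σ (Hom D X) λ u → (u ∘ c ≈ x₁) × (u ∘ d ≈ x₂) ×
              (∀ (u' : Hom D X) → u' ∘ c ≈ x₁ → u' ∘ d ≈ x₂ → u' ≈ u)
  mediate X x₁ x₂ x₁a≈x₂b = u , u∘c≈x₁ , u∘d≈x₂ , unique
    where
    agreeᵛ : ∀ {r x} → vm c r ≡ vm d x → vm x₁ r ≡ vm x₂ x
    agreeᵛ eq with overlapᵛ eq
    ... | k , refl , refl = proj₁ x₁a≈x₂b k

    agreeᵉ : ∀ {r x} → em c r ≡ em d x → em x₁ r ≡ em x₂ x
    agreeᵉ eq with overlapᵉ eq
    ... | k , refl , refl = proj₂ x₁a≈x₂b k

    module Gᵛ = Glue (proj₁ c-match) (proj₁ d-match) (vm x₁) (vm x₂) agreeᵛ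
    module Gᵉ = Glue (proj₂ c-match) (proj₂ d-match) (em x₁) (em x₂) agreeᵉ

    uᵛ : V D → V X
    uᵛ y = Gᵛ.glue (coverᵛ y)

    endpoint-comm : (s : (G : Graph) → E G → V G) →
                    (∀ {G H} (χ : Hom G H) e → vm χ (s G e) ≡ s H (em χ e)) →
                    ∀ {e} (w : Gᵉ.Covered e) → uᵛ (s D e) ≡ s X (Gᵉ.glue w)
    endpoint-comm s s-comm (inj₁ (r , refl)) =
      trans (Gᵛ.glue-irrelevant (coverᵛ _) (inj₁ (s B r , s-comm c r))) (s-comm x₁ r)
    endpoint-comm s s-comm (inj₂ (x , refl)) =
      trans (Gᵛ.glue-irrelevant (coverᵛ _) (inj₂ (s C x , s-comm d x))) (s-comm x₂ x)

    u : Hom D X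
    u = record
      { vm = uᵛ ; em = λ e → Gᵉ.glue (coverᵉ e)
      ; src-comm = λ e → endpoint-comm src src-comm (coverᵉ e)
      ; tgt-comm = λ e → endpoint-comm tgt tgt-comm (coverᵉ e)
      }

    u∘c≈x₁ : u ∘ c ≈ x₁
    u∘c≈x₁ = (λ r → Gᵛ.glue-irrelevant (coverᵛ _) (inj₁ (r , refl))) ,
             (λ r → Gᵉ.glue-irrelevant (coverᵉ _) (inj₁ (r , refl)))

    u∘d≈x₂ : u ∘ d ≈ x₂
    u∘d≈x₂ = (λ x → Gᵛ.glue-irrelevant (coverᵛ _) (inj₂ (x , refl))) ,
             (λ x → Gᵉ.glue-irrelevant (coverᵉ _) (inj₂ (x , refl)))

    unique : ∀ (u' : Hom D X) → u' ∘ c ≈ x₁ → u' ∘ d ≈ x₂ → u' ≈ u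
    unique u' (u'c≈ᵛ , u'c≈ᵉ) (u'd≈ᵛ , u'd≈ᵉ) =
      (λ y → Gᵛ.glue-unique (vm u') u'c≈ᵛ u'd≈ᵛ (coverᵛ y)) ,
      (λ e → Gᵉ.glue-unique (em u') u'c≈ᵉ u'd≈ᵉ (coverᵉ e))

Point : Graph
Point = record { nV = 1 ; nE = 0 ; src = λ () ; tgt = λ () }

pointAt : V A → Hom Point A
pointAt y = record { vm = λ _ → y ; em = λ () ; src-comm = λ () ; tgt-comm = λ () }

Arrow : Graph
Arrow = record { nV = 2 ; nE = 1 ; src = λ _ → 0F ; tgt = λ _ → 1F }

arrowAt : E A → Hom Arrow A
arrowAt {A} y = record
  { vm = λ { 0F → src A y ; 1F → tgt A y } ; em = λ _ → y
  ; src-comm = λ _ → refl ; tgt-comm = λ _ → refl }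

module _ {a : Hom A B} {b : Hom A C} {c : Hom B D} {d : Hom C D} (pb : IsPullback a b c d) where

  pullback-liftᵛ : ∀ {y x} → vm c y ≡ vm d x → Imᵛ b x
  pullback-liftᵛ {y} {x} cy≡dx =
    let (u , _ , b∘u≈ , _) = proj₂ pb Point (pointAt y) (pointAt x) ((λ _ → cy≡dx) , λ ())
    in vm u 0F , proj₁ b∘u≈ 0F

  pullback-liftᵉ : ∀ {y x} → em c y ≡ em d x → Imᵉ b x
  pullback-liftᵉ {y} {x} cy≡dx =
    let (u , _ , b∘u≈ , _) = proj₂ pb Arrow (arrowAt y) (arrowAt x) (endpoints , λ _ → cy≡dx)
    in em u 0F , proj₂ b∘u≈ 0F
    where
    endpoints : ∀ v → vm c (vm (arrowAt y) v) ≡ vm d (vm (arrowAt x) v)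
    endpoints 0F = trans (src-comm c y) (trans (cong (src D) cy≡dx) (sym (src-comm d x)))
    endpoints 1F = trans (tgt-comm c y) (trans (cong (tgt D) cy≡dx) (sym (tgt-comm d x)))

IsPullback-extend : {a : Hom A B} {b : Hom A C} {c : Hom B D} {d : Hom C D} → IsPullback a b c d →
                    (m : Hom D Y) → IsMatch m → {c⁺ : Hom B Y} → m ∘ c ≈ c⁺ → IsPullback a b c⁺ (m ∘ d)
IsPullback-extend {A} {B} {C} {D} {Y} {a} {b} {c} {d} (ca≈db , universal) m m-match {c⁺} mc≈c⁺ =
  commutes , universal⁺
  where
  open ≈-Reasoning

  commutes : c⁺ ∘ a ≈ m ∘ d ∘ b
  commutes = begin
    c⁺ ∘ a     ≈⟨ ∘-congʳ a {m ∘ c} {c⁺} mc≈c⁺ ⟨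
    m ∘ c ∘ a  ≈⟨ ∘-congˡ m {c ∘ a} {d ∘ b} ca≈db ⟩
    m ∘ d ∘ b  ∎

  universal⁺ : ∀ X (x₁ : Hom X B) (x₂ : Hom X C) → c⁺ ∘ x₁ ≈ m ∘ d ∘ x₂ →
               Σ (Hom X A) λ u → (a ∘ u ≈ x₁) × (b ∘ u ≈ x₂) ×
                 (∀ (u' : Hom X A) → a ∘ u' ≈ x₁ → b ∘ u' ≈ x₂ → u' ≈ u)
  universal⁺ X x₁ x₂ c⁺x₁≈mdx₂ = universal X x₁ x₂ (match-cancelˡ m m-match {c ∘ x₁} {d ∘ x₂} (begin
    m ∘ c ∘ x₁  ≈⟨ ∘-congʳ x₁ {m ∘ c} {c⁺} mc≈c⁺ ⟩
    c⁺ ∘ x₁     ≈⟨ c⁺x₁≈mdx₂ ⟩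
    m ∘ d ∘ x₂  ∎))

record Restriction {A B C D : Graph} (b : Hom A C) (c : Hom B D) (d : Hom C D) : Set₁ where
  field
    C′ D′ : Graph
    ι : Hom C′ C
    m : Hom D′ D
    ι-match : IsMatch ι
    m-match : IsMatch m
    b′ : Hom A C′
    c′ : Hom B D′
    d′ : Hom C′ D′
    b-factor : ι ∘ b′ ≈ b
    c-factor : m ∘ c′ ≈ c
    d-factor : m ∘ d′ ≈ d ∘ ι
    d-preimageᵛ : ∀ x → Imᵛ m (vm d x) → Imᵛ ι x
    d-preimageᵉ : ∀ e → Imᵉ m (em d e) → Imᵉ ι e

module _ {a : Hom A B} {b : Hom A C} {c : Hom B D} {d : Hom C D} (r : Restriction b c d) where
  open Restriction r
  open ≈-Reasoning

  b′-uncancel : (u : Hom X A) (x : Hom X C′) → b′ ∘ u ≈ x → b ∘ u ≈ ι ∘ x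
  b′-uncancel u x b′u≈x = begin
    b ∘ u       ≈⟨ ∘-congʳ u {ι ∘ b′} {b} b-factor ⟨
    ι ∘ b′ ∘ u  ≈⟨ ∘-congˡ ι {b′ ∘ u} {x} b′u≈x ⟩
    ι ∘ x       ∎

  b′-cancel : (u : Hom X A) (x : Hom X C′) → b ∘ u ≈ ι ∘ x → b′ ∘ u ≈ x
  b′-cancel u x bu≈ιx = match-cancelˡ ι ι-match {b′ ∘ u} {x} (begin
    ι ∘ b′ ∘ u  ≈⟨ ∘-congʳ u {ι ∘ b′} {b} b-factor ⟩
    b ∘ u       ≈⟨ bu≈ιx ⟩
    ι ∘ x       ∎)

  restriction-commutes : c ∘ a ≈ d ∘ b → c′ ∘ a ≈ d′ ∘ b′
  restriction-commutes ca≈db = match-cancelˡ m m-match {c′ ∘ a} {d′ ∘ b′} (begin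
    m ∘ c′ ∘ a   ≈⟨ ∘-congʳ a {m ∘ c′} {c} c-factor ⟩
    c ∘ a        ≈⟨ ca≈db ⟩
    d ∘ b        ≈⟨ ∘-congˡ d {ι ∘ b′} {b} b-factor ⟨
    d ∘ ι ∘ b′   ≈⟨ ∘-congʳ b′ {m ∘ d′} {d ∘ ι} d-factor ⟨
    m ∘ d′ ∘ b′  ∎)

  IsPullback-restrict : IsPullback a b c d → IsPullback a b′ c′ d′
  IsPullback-restrict (ca≈db , universal) = restriction-commutes ca≈db , universal′
    where
    universal′ : ∀ X (x₁ : Hom X B) (x₂ : Hom X C′) → c′ ∘ x₁ ≈ d′ ∘ x₂ →
                 Σ (Hom X A) λ u → (a ∘ u ≈ x₁) × (b′ ∘ u ≈ x₂) ×
                   (∀ (u' : Hom X A) → a ∘ u' ≈ x₁ → b′ ∘ u' ≈ x₂ → u' ≈ u)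
    universal′ X x₁ x₂ c′x₁≈d′x₂ =
      let (u , au≈x₁ , bu≈ιx₂ , unique) = universal X x₁ (ι ∘ x₂) (begin
            c ∘ x₁       ≈⟨ ∘-congʳ x₁ {m ∘ c′} {c} c-factor ⟨
            m ∘ c′ ∘ x₁  ≈⟨ ∘-congˡ m {c′ ∘ x₁} {d′ ∘ x₂} c′x₁≈d′x₂ ⟩
            m ∘ d′ ∘ x₂  ≈⟨ ∘-congʳ x₂ {m ∘ d′} {d ∘ ι} d-factor ⟩
            d ∘ ι ∘ x₂   ∎)
      in u , au≈x₁ , b′-cancel u x₂ bu≈ιx₂ , λ u' au'≈x₁ b′u'≈x₂ → unique u' au'≈x₁ (b′-uncancel u' x₂ b′u'≈x₂)

  preimage-factor : (u₀ : Hom X C) (y : Hom X D′) → d ∘ u₀ ≈ m ∘ y →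
                    Σ (Hom X C′) λ u → (ι ∘ u ≈ u₀) × (d′ ∘ u ≈ y)
  preimage-factor u₀ y du₀≈my =
    let (u , ιu≈u₀) = factorise ι ι-match u₀
          (λ x → d-preimageᵛ (vm u₀ x) (vm y x , sym (proj₁ du₀≈my x)))
          (λ e → d-preimageᵉ (em u₀ e) (em y e , sym (proj₂ du₀≈my e)))
    in u , ιu≈u₀ , match-cancelˡ m m-match {d′ ∘ u} {y} (begin
      m ∘ d′ ∘ u  ≈⟨ ∘-congʳ u {m ∘ d′} {d ∘ ι} d-factor ⟩
      d ∘ ι ∘ u   ≈⟨ ∘-congˡ d {ι ∘ u} {u₀} ιu≈u₀ ⟩
      d ∘ u₀      ≈⟨ du₀≈my ⟩
      m ∘ y       ∎)

  IsFPBC-restrict : IsFPBC a c b d → IsFPBC a c′ b′ d′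
  IsFPBC-restrict (pb , final) = IsPullback-restrict pb , final′
    where
    final′ : ∀ (P Q : Graph) (f₁' : Hom P B) (g₁' : Hom P Q) (g₂' : Hom Q D′) →
             IsPullback f₁' g₁' c′ g₂' → (p : Hom P A) → a ∘ p ≈ f₁' →
             Σ (Hom Q C′) λ u → (d′ ∘ u ≈ g₂') × (u ∘ g₁' ≈ b′ ∘ p) ×
               (∀ (u' : Hom Q C′) → d′ ∘ u' ≈ g₂' → u' ∘ g₁' ≈ b′ ∘ p → u' ≈ u)
    final′ P Q f₁' g₁' g₂' pbQ p ap≈f₁' =
      let (u₀ , du₀≈mg₂' , u₀g₁'≈bp , unique₀) =
            final P Q f₁' g₁' (m ∘ g₂')
              (IsPullback-extend {a = f₁'} {g₁'} {c′} {g₂'} pbQ m m-match {c} c-factor) p ap≈f₁'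
          (u , ιu≈u₀ , d′u≈g₂') = preimage-factor u₀ g₂' du₀≈mg₂'
          ιu'≈u₀ : ∀ u' → d′ ∘ u' ≈ g₂' → u' ∘ g₁' ≈ b′ ∘ p → ι ∘ u' ≈ u₀
          ιu'≈u₀ u' d′u'≈g₂' u'g₁'≈b′p = unique₀ (ι ∘ u')
            (begin
              d ∘ ι ∘ u'   ≈⟨ ∘-congʳ u' {m ∘ d′} {d ∘ ι} d-factor ⟨
              m ∘ d′ ∘ u'  ≈⟨ ∘-congˡ m {d′ ∘ u'} {g₂'} d′u'≈g₂' ⟩
              m ∘ g₂'      ∎)
            (begin
              ι ∘ u' ∘ g₁'  ≈⟨ ∘-congˡ ι {u' ∘ g₁'} {b′ ∘ p} u'g₁'≈b′p ⟩
              ι ∘ b′ ∘ p    ≈⟨ ∘-congʳ p {ι ∘ b′} {b} b-factor ⟩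
              b ∘ p         ∎)
      in u , d′u≈g₂' ,
         match-cancelˡ ι ι-match {u ∘ g₁'} {b′ ∘ p} (begin
           ι ∘ u ∘ g₁'  ≈⟨ ∘-congʳ g₁' {ι ∘ u} {u₀} ιu≈u₀ ⟩
           u₀ ∘ g₁'     ≈⟨ u₀g₁'≈bp ⟩
           b ∘ p        ≈⟨ ∘-congʳ p {ι ∘ b′} {b} b-factor ⟨
           ι ∘ b′ ∘ p   ∎) ,
         λ u' d′u'≈g₂' u'g₁'≈b′p → match-cancelˡ ι ι-match {u'} {u} (begin
           ι ∘ u'  ≈⟨ ιu'≈u₀ u' d′u'≈g₂' u'g₁'≈b′p ⟩
           u₀      ≈⟨ ιu≈u₀ ⟨
           ι ∘ u   ∎)

  module _ (sq : IsElementwisePushout a b c d) where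
    open IsElementwisePushout sq

    private
      coverᵛ′ : ∀ y → Imᵛ c′ y ⊎ Imᵛ d′ y
      coverᵛ′ y with coverᵛ (vm m y)
      ... | inj₁ y∈c = inj₁ (Imᵛ-cancel m m-match {c′} {c} c-factor y∈c)
      ... | inj₂ (x , dx≡my) =
        let (i , ιi≡x) = d-preimageᵛ x (y , sym dx≡my)
        in inj₂ (Imᵛ-cancel m m-match {d′} {d ∘ ι} d-factor (i , trans (cong (vm d) ιi≡x) dx≡my))

      coverᵉ′ : ∀ y → Imᵉ c′ y ⊎ Imᵉ d′ y
      coverᵉ′ y with coverᵉ (em m y)
      ... | inj₁ y∈c = inj₁ (Imᵉ-cancel m m-match {c′} {c} c-factor y∈c)
      ... | inj₂ (x , dx≡my) =
        let (i , ιi≡x) = d-preimageᵉ x (y , sym dx≡my)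
        in inj₂ (Imᵉ-cancel m m-match {d′} {d ∘ ι} d-factor (i , trans (cong (em d) ιi≡x) dx≡my))

      overlapᵛ′ : ∀ {r x} → vm c′ r ≡ vm d′ x → ∃ λ k → vm a k ≡ r × vm b′ k ≡ x
      overlapᵛ′ {r} {x} c′r≡d′x =
        let (k , ak≡r , bk≡ιx) = overlapᵛ
              (trans (sym (proj₁ c-factor r)) (trans (cong (vm m) c′r≡d′x) (proj₁ d-factor x)))
        in k , ak≡r , proj₁ ι-match (trans (proj₁ b-factor k) bk≡ιx)

      overlapᵉ′ : ∀ {r x} → em c′ r ≡ em d′ x → ∃ λ k → em a k ≡ r × em b′ k ≡ x
      overlapᵉ′ {r} {x} c′r≡d′x =
        let (k , ak≡r , bk≡ιx) = overlapᵉ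
              (trans (sym (proj₂ c-factor r)) (trans (cong (em m) c′r≡d′x) (proj₂ d-factor x)))
        in k , ak≡r , proj₂ ι-match (trans (proj₂ b-factor k) bk≡ιx)

    IsElementwisePushout-restrict : IsElementwisePushout a b′ c′ d′
    IsElementwisePushout-restrict = record
      { commutes = restriction-commutes commutes
      ; c-match = IsMatch-factor m {c′} {c} c-factor c-match
      ; d-match = IsMatch-factor m {d′} {d ∘ ι} d-factor (IsMatch-∘ {ψ = d} {ι} d-match ι-match)
      ; coverᵛ = coverᵛ′ ; coverᵉ = coverᵉ′
      ; overlapᵛ = overlapᵛ′ ; overlapᵉ = overlapᵉ′
      }

module Restricted {L R G H T : Graph} (α : Rule L R)
  (f : Hom L G) (g : Hom R H) (g₁ : Hom R T) (g₂ : Hom T H) {D : Graph} (h : Hom (K α) D) (β₁ : Hom D G) (β₂ : Hom D H)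
  (f-match : IsMatch f) (g-match : IsMatch g) (g₁-match : IsMatch g₁) (g₂-match : IsMatch g₂)
  (h-match : IsMatch h) (β₁-match : IsMatch β₁) (β₂-match : IsMatch β₂)
  (fpbc : IsFPBC (α₁ α) f h β₁) (po : IsPushout (α₂ α) h g β₂) (g₂g₁≈g : g₂ ∘ g₁ ≈ g) where

  D′-sub : Subgraph D
  D′-sub = preimage β₂ (image g₂)

  D′ : Graph
  D′ = ⟦ D′-sub ⟧

  ιD : Hom D′ D
  ιD = inclusion D′-sub

  ιD-match : IsMatch ιD
  ιD-match = inclusion-match D′-sub

  h′-factor : Σ (Hom (K α) D′) λ h′ → ιD ∘ h′ ≈ h
  h′-factor = factorise ιD ιD-match h
    (λ k → inclusion-completeᵛ D′-sub (vm g₁ (vm (α₂ α) k) , trans (proj₁ g₂g₁≈g _) (proj₁ (proj₁ po) k)))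
    (λ k → inclusion-completeᵉ D′-sub (em g₁ (em (α₂ α) k) , trans (proj₂ g₂g₁≈g _) (proj₂ (proj₁ po) k)))

  h′ : Hom (K α) D′
  h′ = proj₁ h′-factor

  β₂′-factor : Σ (Hom D′ T) λ β₂′ → g₂ ∘ β₂′ ≈ β₂ ∘ ιD
  β₂′-factor = factorise g₂ g₂-match (β₂ ∘ ιD) (inclusion-soundᵛ D′-sub) (inclusion-soundᵉ D′-sub)

  β₂′ : Hom D′ T
  β₂′ = proj₁ β₂′-factor

  G′-sub : Subgraph G
  G′-sub = image f ∪ image (β₁ ∘ ιD)

  G′ : Graph
  G′ = ⟦ G′-sub ⟧

  ιG : Hom G′ G
  ιG = inclusion G′-sub

  ιG-match : IsMatch ιG
  ιG-match = inclusion-match G′-sub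

  f₁-factor : Σ (Hom L G′) λ f₁ → ιG ∘ f₁ ≈ f
  f₁-factor = factorise ιG ιG-match f
    (λ l → inclusion-completeᵛ G′-sub (inj₁ (l , refl)))
    (λ l → inclusion-completeᵉ G′-sub (inj₁ (l , refl)))

  f₁ : Hom L G′
  f₁ = proj₁ f₁-factor

  β₁′-factor : Σ (Hom D′ G′) λ β₁′ → ιG ∘ β₁′ ≈ β₁ ∘ ιD
  β₁′-factor = factorise ιG ιG-match (β₁ ∘ ιD)
    (λ i → inclusion-completeᵛ G′-sub (inj₂ (i , refl)))
    (λ i → inclusion-completeᵉ G′-sub (inj₂ (i , refl)))

  β₁′ : Hom D′ G′
  β₁′ = proj₁ β₁′-factor

  β₁-preimageᵛ : ∀ x → Imᵛ ιG (vm β₁ x) → Imᵛ ιD x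
  β₁-preimageᵛ x (y , ιGy≡β₁x) with inclusion-soundᵛ G′-sub y
  ... | inj₁ (l , fl≡ιGy) =
    Imᵛ-factor ιD {h′} {h} (proj₂ h′-factor)
      (pullback-liftᵛ {a = α₁ α} {h} {f} {β₁} (proj₁ fpbc) (trans fl≡ιGy ιGy≡β₁x))
  ... | inj₂ (i , β₁ιDi≡ιGy) = i , proj₁ β₁-match (trans β₁ιDi≡ιGy ιGy≡β₁x)

  β₁-preimageᵉ : ∀ x → Imᵉ ιG (em β₁ x) → Imᵉ ιD x
  β₁-preimageᵉ x (y , ιGy≡β₁x) with inclusion-soundᵉ G′-sub y
  ... | inj₁ (l , fl≡ιGy) =
    Imᵉ-factor ιD {h′} {h} (proj₂ h′-factor)
      (pullback-liftᵉ {a = α₁ α} {h} {f} {β₁} (proj₁ fpbc) (trans fl≡ιGy ιGy≡β₁x))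
  ... | inj₂ (i , β₁ιDi≡ιGy) = i , proj₂ β₁-match (trans β₁ιDi≡ιGy ιGy≡β₁x)

  left-restriction : Restriction h f β₁
  left-restriction = record
    { C′ = D′ ; D′ = G′ ; ι = ιD ; m = ιG ; ι-match = ιD-match ; m-match = ιG-match
    ; b′ = h′ ; c′ = f₁ ; d′ = β₁′
    ; b-factor = proj₂ h′-factor ; c-factor = proj₂ f₁-factor ; d-factor = proj₂ β₁′-factor
    ; d-preimageᵛ = β₁-preimageᵛ ; d-preimageᵉ = β₁-preimageᵉ
    }

  right-restriction : Restriction h g β₂
  right-restriction = record
    { C′ = D′ ; D′ = T ; ι = ιD ; m = g₂ ; ι-match = ιD-match ; m-match = g₂-match
    ; b′ = h′ ; c′ = g₁ ; d′ = β₂′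
    ; b-factor = proj₂ h′-factor ; c-factor = g₂g₁≈g ; d-factor = proj₂ β₂′-factor
    ; d-preimageᵛ = λ _ → inclusion-completeᵛ D′-sub ; d-preimageᵉ = λ _ → inclusion-completeᵉ D′-sub
    }

  derivation : Derivation α f₁ g₁
  derivation =
    D′ , h′ , β₁′ , β₂′ ,
    IsMatch-factor ιD {h′} {h} (proj₂ h′-factor) h-match ,
    IsFPBC-restrict {a = α₁ α} left-restriction fpbc ,
    elementwise⇒pushout (IsElementwisePushout-restrict {a = α₂ α} right-restriction
                           (pushout⇒elementwise po g-match β₂-match)) ,
    g₁-match ,
    IsMatch-factor ιG {β₁′} {β₁ ∘ ιD} (proj₂ β₁′-factor) (IsMatch-∘ {ψ = β₁} {ιD} β₁-match ιD-match) ,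
    IsMatch-factor g₂ {β₂′} {β₂ ∘ ιD} (proj₂ β₂′-factor) (IsMatch-∘ {ψ = β₂} {ιD} β₂-match ιD-match)

  derivable : Derivable α g₁
  derivable = G′ , f₁ , IsMatch-factor ιG {f₁} {f} (proj₂ f₁-factor) f-match , derivation

lemma5 : {L R G H T : Graph} (α : Rule L R)
         (f : Hom L G) (g : Hom R H) (g₁ : Hom R T) →
         IsMatch f → IsMatch g → IsMatch g₁ →
         Derivation α f g → ¬ Derivable α g₁ →
         ¬ Σ (Hom T H) (λ g₂ → IsMatch g₂ × (g₂ ∘ g₁ ≈ g))
lemma5 α f g g₁ f-match g-match g₁-match (D , h , β₁ , β₂ , h-match , fpbc , po , _ , β₁-match , β₂-match)
       not-derivable (g₂ , g₂-match , g₂g₁≈g) =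
  not-derivable (Restricted.derivable α f g g₁ g₂ h β₁ β₂ f-match g-match g₁-match g₂-match
                   h-match β₁-match β₂-match fpbc po g₂g₁≈g)
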